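{- Let $\tau_2=13\underline{2}$. For $n\ge1$ and any integer $k$, let $P_{n,\tau_2,k}(x)=\sum x^{pmp_{\tau_2}(\sigma)}$, the sum over all $\sigma\in S_n$ with $\sigma_k=1$ (so $P_{n,\tau_2,k}(x)=0$ for $k>n$). Then for all $n\ge2$ and $1\le k\le n$, $$P_{n,\tau_2,k}(x)=\sum_{\ell=1}^{k-1}P_{n-1,\tau_2,\ell}(x)+\bigl(x(n-k-1)+1\bigr)P_{n-1,\tau_2,k}(x).$$
   Context: For $\sigma\in S_n$, $\sigma$ has a $13\underline{2}$-match at position $m$ if there exist $i<j<m$ with $\sigma_i<\sigma_m<\sigma_j$; $pmp_{13\underline{2}}(\sigma)$ is the number of such positions $m$. -}

module Defs where

open import Data.Bool using (Bool; true; false; _∧_; not; if_then_else_)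
open import Data.Nat using (ℕ; zero; suc; _+_; _∸_; _≡ᵇ_)
open import Data.Fin using (Fin; toℕ; _<?_; _≟_) renaming (zero to fzero)
open import Data.List using (List; []; _∷_; [_]; map; concatMap; filter; length; allFin)
open import Data.Bool.ListAction using (any; all)
open import Data.Vec using (Vec; []; _∷_; lookup)
open import Data.Integer using (ℤ; +_)
open import Relation.Nullary using (does)
open import Relation.Nullary.Decidable using (⌊_⌋)
open import Relation.Unary using (Decidable)
open import Relation.Binary.PropositionalEquality using (_≡_)

allVecs : (m n : ℕ) → List (Vec (Fin m) n)
allVecs m zero = [ [] ]
allVecs m (suc n) = concatMap (λ i → map (i ∷_) (allVecs m n)) (allFin m)

-- A word σ : Vec (Fin n) n is a permutation of S_n iff its entries are distinct.
-- Values are 0-based: value v : Fin n stands for toℕ v + 1; positions likewise.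
isPerm : {n : ℕ} → Vec (Fin n) n → Bool
isPerm {n} σ =
  all (λ p → all (λ q → ⌊ p ≟ q ⌋ Data.Bool.∨ not ⌊ lookup σ p ≟ lookup σ q ⌋) (allFin n)) (allFin n)

Sn : (n : ℕ) → List (Vec (Fin n) n)
Sn n = filter (λ σ → Data.Bool._≟_ (isPerm σ) true) (allVecs n n)

match132 : {n : ℕ} → Vec (Fin n) n → Fin n → Bool
match132 {n} σ m =
  any (λ j → any (λ i →
        ⌊ i <? j ⌋ ∧ ⌊ j <? m ⌋ ∧ ⌊ lookup σ i <? lookup σ m ⌋ ∧ ⌊ lookup σ m <? lookup σ j ⌋)
      (allFin n)) (allFin n)

pmp132 : {n : ℕ} → Vec (Fin n) n → ℕ
pmp132 {n} σ = length (filter (λ m → Data.Bool._≟_ (match132 σ m) true) (allFin n))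

-- σ_k = 1 (k is a 1-based position; false if k = 0 or k > n).
atOne : {n : ℕ} → ℕ → Vec (Fin n) n → Bool
atOne {n} k σ = any (λ p → ((toℕ p + 1) ≡ᵇ k) ∧ isZero (lookup σ p)) (allFin n)
  where
  isZero : Fin n → Bool
  isZero v = toℕ v ≡ᵇ 0

-- Polynomials in x with integer coefficients, as coefficient sequences.
Poly : Set
Poly = ℕ → ℤ

_⊕_ : Poly → Poly → Poly
(p ⊕ q) j = p j Data.Integer.+ q j

_⊙_ : ℤ → Poly → Poly
(c ⊙ p) j = c Data.Integer.* p j

X· : Poly → Poly
X· p zero = + 0
X· p (suc j) = p j

ΣP : ℕ → (ℕ → Poly) → Poly
ΣP zero f j = + 0
ΣP (suc b) f j = ΣP b f j Data.Integer.+ f (suc b) j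

P : ℕ → ℕ → Poly
P n k j = + length (filter (λ σ → Data.Bool._≟_ (atOne k σ ∧ (pmp132 σ ≡ᵇ j)) true) (Sn n))

{-# OPTIONS --safe #-}
module Submission where

-- Let σ ∈ S_n with σ_k = 1, and let p be the position of the entry 2.  If p < k, deleting the
-- 1 leaves τ ∈ S_{n-1} with τ_p = 1 and the same number of 13-2 matches: in a match whose "1"
-- was the deleted entry, the 2 at p takes its place.  If p > k, deleting the 2 leaves τ with
-- τ_k = 1; now the 1 at k replaces the 2 in every match, and p itself is a match position exactly
-- when p > k + 1, with the 1 at k and the entry at k + 1 as witnesses.  Hence σ ↦ (p , τ) is a
-- bijection onto the pairs with p ≠ k and a condition on τ depending on p, and summing over p
-- gives the terms P_{n-1,ℓ} for ℓ < k, one P_{n-1,k} for p = k + 1 and n - k - 1 copies of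
-- x·P_{n-1,k} for p > k + 1.

open import Defs
open import Data.Bool as Bool using (Bool; true; false; T; _∧_; not)
import Data.Bool.ListAction
open import Data.Bool.Properties using (T-≡; T-∧; T-∨)
open import Data.Empty using (⊥-elim)
open import Data.Fin as Fin using (Fin; toℕ; _<_; punchIn; punchOut; fromℕ<) renaming (zero to fzero; suc to fsuc)
open import Data.Fin.Properties
  using ( toℕ-injective; toℕ<n; toℕ-fromℕ<; any?; injective⇒≤
        ; punchIn-injective; punchInᵢ≢i; punchIn-punchOut; punchOut-injective; punchIn-mono-≤; punchIn-cancel-≤)
open import Data.Integer using (ℤ; +_; _-_) renaming (_+_ to _+ℤ_; _*_ to _*ℤ_)
import Data.Integer.Properties as ℤ
open import Data.List
  using (List; []; _∷_; [_]; _++_; length; map; filter; allFin; tabulate; concatMap; cartesianProductWith; cartesianProduct)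
open import Data.List.Membership.Propositional using (_∈_; lose)
open import Data.List.Membership.Propositional.Properties
  using ( ∈-map⁺; ∈-map⁻; ∈-filter⁺; ∈-filter⁻; ∈-allFin
        ; ∈-cartesianProductWith⁺; ∈-cartesianProduct⁺; ∈-cartesianProduct⁻)
open import Data.List.Membership.Propositional.Properties.WithK using (unique∧set⇒bag)
open import Data.List.Properties
  using (length-++; length-map; filter-++; filter-≐; filter-none; filter-accept; filter-reject; map-tabulate)
open import Data.List.Relation.Binary.BagAndSetEquality using (∼bag⇒↭)
open import Data.List.Relation.Binary.Permutation.Propositional using (_↭_)
open import Data.List.Relation.Binary.Permutation.Propositional.Properties using (↭-length; filter-↭)
open import Data.List.Relation.Unary.All as All using (All; []; _∷_)
import Data.List.Relation.Unary.All.Properties as All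
open import Data.List.Relation.Unary.AllPairs using ([]; _∷_)
open import Data.List.Relation.Unary.Any using (here; there; satisfied)
open import Data.List.Relation.Unary.Any.Properties using (any⁺; any⁻)
open import Data.List.Relation.Unary.Unique.Propositional using (Unique)
import Data.List.Relation.Unary.Unique.Propositional.Properties as Unique
open import Data.List.Relation.Unary.Unique.Propositional.Properties using (cartesianProductWith⁺; cartesianProduct⁺; allFin⁺; filter⁺)
open import Data.Nat as ℕ using (ℕ; zero; suc; _+_; _*_; _∸_; _≤_; z≤n; s≤s; _≡ᵇ_)
open import Data.Nat.ListAction using (sum)
open import Data.Nat.Properties
  using ( ≡ᵇ⇒≡; ≡⇒≡ᵇ; suc-injective; 1+n≢n; +-assoc; +-comm; +-suc; +-identityʳ
        ; ≤-refl; ≤-trans; <-trans; <-irrefl; <-cmp; <⇒≱; ≰⇒>; ≤∧≢⇒<; n≮n; n<1+n; n<1⇒n≡0; n≢0⇒n>0; m≤m+n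
        ; m≤n⇒m<n∨m≡n; m≤n⇒∃[o]m+o≡n)
open import Data.Product using (∃; _×_; _,_; proj₁; proj₂)
open import Data.Sum using (_⊎_; inj₁; inj₂)
open import Data.Vec as Vec using (Vec; []; _∷_; lookup; insertAt)
open import Data.Vec.Properties
  using (∷-injective; insertAt-lookup; insertAt-punchIn; lookup-map; lookup∘tabulate; tabulate∘lookup; tabulate-cong)
open import Function using (_∘_; const; id)
open import Function.Bundles using (_⇔_; mk⇔; Equivalence)
open import Function.Definitions using (Injective)
open import Relation.Binary.Definitions using (tri<; tri≈; tri>)
open import Relation.Binary.PropositionalEquality
  using (_≡_; _≢_; refl; sym; trans; cong; cong₂; subst; subst₂; _≗_; module ≡-Reasoning)
open import Relation.Nullary using (¬_; yes; no)
open import Relation.Nullary.Decidable using (⌊_⌋; toWitness; fromWitness; toWitnessFalse; fromWitnessFalse)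

private variable
  A B : Set
  n : ℕ

count : (A → Bool) → List A → ℕ
count f xs = length (filter (λ x → f x Bool.≟ true) xs)

count-++ : ∀ (f : A → Bool) xs ys → count f (xs ++ ys) ≡ count f xs + count f ys
count-++ f xs ys = trans (cong length (filter-++ _ xs ys)) (length-++ (filter _ xs))

count-map : ∀ (f : B → Bool) (g : A → B) xs → count f (map g xs) ≡ count (f ∘ g) xs
count-map f g [] = refl
count-map f g (x ∷ xs) with f (g x)
... | true  = cong suc (count-map f g xs)
... | false = count-map f g xs

count-cong : ∀ {f g : A → Bool} → (∀ x → T (f x) ⇔ T (g x)) → ∀ xs → count f xs ≡ count g xs
count-cong {f = f} {g} f⇔g xs =
  cong length (filter-≐ _ _ ( (λ {x} → via (f x) (g x) (Equivalence.to (f⇔g x)))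
                            , (λ {x} → via (g x) (f x) (Equivalence.from (f⇔g x)))) xs)
  where
  via : ∀ a b → (T a → T b) → a ≡ true → b ≡ true
  via a b a⇒b a≡true = Equivalence.to T-≡ (a⇒b (Equivalence.from T-≡ a≡true))

count-none : ∀ {f : A → Bool} → (∀ x → ¬ T (f x)) → ∀ xs → count f xs ≡ 0
count-none ¬f xs = cong length (filter-none _ (All.universal (λ x fx≡true → ¬f x (Equivalence.from T-≡ fx≡true)) xs))

count-[x]-reject : ∀ (f : A → Bool) x → ¬ T (f x) → count f [ x ] ≡ 0
count-[x]-reject f x ¬fx = cong length (filter-reject (λ y → f y Bool.≟ true) (¬fx ∘ Equivalence.from T-≡))

count-[x]-accept : ∀ (f : A → Bool) x → T (f x) → count f [ x ] ≡ 1
count-[x]-accept f x fx = cong length (filter-accept (λ y → f y Bool.≟ true) (Equivalence.to T-≡ fx))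

count-↭ : ∀ (f : A → Bool) {xs ys} → xs ↭ ys → count f xs ≡ count f ys
count-↭ f xs↭ys = ↭-length (filter-↭ _ xs↭ys)

count-cartesianProduct : ∀ (f : A × B → Bool) xs ys →
  count f (cartesianProduct xs ys) ≡ sum (map (λ x → count (f ∘ (x ,_)) ys) xs)
count-cartesianProduct f [] ys = refl
count-cartesianProduct f (x ∷ xs) ys = begin
  count f (map (x ,_) ys ++ cartesianProduct xs ys)          ≡⟨ count-++ f (map (x ,_) ys) _ ⟩
  count f (map (x ,_) ys) + count f (cartesianProduct xs ys) ≡⟨ cong₂ _+_ (count-map f _ ys) (count-cartesianProduct f xs ys) ⟩
  count (f ∘ (x ,_)) ys + sum (map (λ x → count (f ∘ (x ,_)) ys) xs) ∎
  where
  open ≡-Reasoning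

unique∧sameElements⇒↭ : {xs ys : List A} → Unique xs → Unique ys → (∀ {x} → x ∈ xs ⇔ x ∈ ys) → xs ↭ ys
unique∧sameElements⇒↭ xs! ys! xs≈ys = ∼bag⇒↭ (unique∧set⇒bag xs! ys! xs≈ys)

InjectiveOn : (A → B) → List A → Set
InjectiveOn g ys = ∀ {y y′} → y ∈ ys → y′ ∈ ys → g y ≡ g y′ → y ≡ y′

map⁺-injectiveOn : ∀ (g : A → B) {ys} → InjectiveOn g ys → Unique ys → Unique (map g ys)
map⁺-injectiveOn g inj [] = []
map⁺-injectiveOn g inj (y∉ys ∷ ys!) =
  All.map⁺ (All.tabulate (λ y′∈ys gy≡gy′ → All.lookup y∉ys y′∈ys (inj (here refl) (there y′∈ys) gy≡gy′)))
  ∷ map⁺-injectiveOn g (λ y∈ y′∈ → inj (there y∈) (there y′∈)) ys!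

length-≡-bijectiveOn : ∀ (g : B → A) {xs ys} → Unique xs → Unique ys → InjectiveOn g ys →
  (∀ {y} → y ∈ ys → g y ∈ xs) → (∀ {x} → x ∈ xs → ∃ λ y → y ∈ ys × g y ≡ x) →
  length xs ≡ length ys
length-≡-bijectiveOn g {xs} {ys} xs! ys! inj into onto =
  trans (↭-length (unique∧sameElements⇒↭ xs! (map⁺-injectiveOn g inj ys!) (mk⇔ to from))) (length-map g ys)
  where
  to : ∀ {x} → x ∈ xs → x ∈ map g ys
  to x∈xs with y , y∈ys , refl ← onto x∈xs = ∈-map⁺ g y∈ys
  from : ∀ {x} → x ∈ map g ys → x ∈ xs
  from x∈ with y , y∈ys , refl ← ∈-map⁻ g x∈ = into y∈ys

sumBelow : ℕ → (ℕ → ℕ) → ℕ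
sumBelow zero    F = 0
sumBelow (suc n) F = F 0 + sumBelow n (F ∘ suc)

sum-allFin : ∀ n (F : ℕ → ℕ) → sum (map (F ∘ toℕ) (allFin n)) ≡ sumBelow n F
sum-allFin n F = trans (cong sum (map-tabulate {n = n} id (F ∘ toℕ))) (sum-tabulate n F)
  where
  sum-tabulate : ∀ n (F : ℕ → ℕ) → sum (tabulate (F ∘ toℕ {n})) ≡ sumBelow n F
  sum-tabulate zero    F = refl
  sum-tabulate (suc n) F = cong (_+_ (F 0)) (sum-tabulate n (F ∘ suc))

sumBelow-+ : ∀ a b F → sumBelow (a + b) F ≡ sumBelow a F + sumBelow b (F ∘ _+_ a)
sumBelow-+ zero    b F = refl
sumBelow-+ (suc a) b F = trans (cong (_+_ (F 0)) (sumBelow-+ a b (F ∘ suc))) (sym (+-assoc (F 0) _ _))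

sumBelow-cong : ∀ n {F G} → (∀ i → i ℕ.< n → F i ≡ G i) → sumBelow n F ≡ sumBelow n G
sumBelow-cong zero    F≡G = refl
sumBelow-cong (suc n) F≡G = cong₂ _+_ (F≡G 0 (s≤s z≤n)) (sumBelow-cong n (λ i i<n → F≡G (suc i) (s≤s i<n)))

sumBelow-const : ∀ n x → sumBelow n (const x) ≡ n * x
sumBelow-const zero    x = refl
sumBelow-const (suc n) x = cong (_+_ x) (sumBelow-const n x)

sumBelow-suc : ∀ n F → sumBelow (suc n) F ≡ sumBelow n F + F n
sumBelow-suc zero    F = +-comm (F 0) 0
sumBelow-suc (suc n) F = trans (cong (_+_ (F 0)) (sumBelow-suc n (F ∘ suc))) (sym (+-assoc (F 0) _ _))

ΣP-sumBelow : ∀ b (f : ℕ → Poly) (g : ℕ → ℕ) j → (∀ ℓ → f ℓ j ≡ + g ℓ) → ΣP b f j ≡ + sumBelow b (g ∘ suc)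
ΣP-sumBelow zero    f g j f≡g = refl
ΣP-sumBelow (suc b) f g j f≡g = begin
  ΣP b f j +ℤ f (suc b) j                    ≡⟨ cong₂ _+ℤ_ (ΣP-sumBelow b f g j f≡g) (f≡g (suc b)) ⟩
  + sumBelow b (g ∘ suc) +ℤ + g (suc b)      ≡⟨ cong +_ (sym (sumBelow-suc b (g ∘ suc))) ⟩
  + sumBelow (suc b) (g ∘ suc)                ∎
  where
  open ≡-Reasoning

data PunchInView (q : Fin (suc n)) : Fin (suc n) → Set where
  at-q    : PunchInView q q
  punched : (r : Fin n) → PunchInView q (punchIn q r)

punchInView : (q a : Fin (suc n)) → PunchInView q a
punchInView q a with a Fin.≟ q
... | yes refl = at-q
... | no a≢q   = subst (PunchInView q) (punchIn-punchOut (a≢q ∘ sym)) (punched (punchOut (a≢q ∘ sym)))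

allFin-punchIn-↭ : ∀ (q : Fin (suc n)) → allFin (suc n) ↭ q ∷ map (punchIn q) (allFin n)
allFin-punchIn-↭ {n} q = unique∧sameElements⇒↭ (allFin⁺ (suc n))
  (All.map⁺ (All.tabulate (λ {r} _ → punchInᵢ≢i q r ∘ sym)) ∷ Unique.map⁺ (punchIn-injective q _ _) (allFin⁺ n))
  (λ {a} → mk⇔ (λ _ → listed (punchInView q a)) (λ _ → ∈-allFin a))
  where
  listed : ∀ {a} → PunchInView q a → a ∈ q ∷ map (punchIn q) (allFin n)
  listed at-q        = here refl
  listed (punched r) = there (∈-map⁺ (punchIn q) (∈-allFin r))

punchIn-mono-< : ∀ (q : Fin (suc n)) r s → r < s → punchIn q r < punchIn q s
punchIn-mono-< q r s r<s = ≰⇒> (λ s′≤r′ → <⇒≱ r<s (punchIn-cancel-≤ q s r s′≤r′))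

punchIn-cancel-< : ∀ (q : Fin (suc n)) r s → punchIn q r < punchIn q s → r < s
punchIn-cancel-< q r s r′<s′ = ≰⇒> (λ s≤r → <⇒≱ r′<s′ (punchIn-mono-≤ q s r s≤r))

toℕ-punchIn-< : ∀ (q : Fin (suc n)) r → r < q → toℕ (punchIn q r) ≡ toℕ r
toℕ-punchIn-< (fsuc q) fzero    _         = refl
toℕ-punchIn-< (fsuc q) (fsuc r) (s≤s r<q) = cong suc (toℕ-punchIn-< q r r<q)

toℕ-punchOut-< : ∀ {q a : Fin (suc n)} (q≢a : q ≢ a) → a < q → toℕ (punchOut q≢a) ≡ toℕ a
toℕ-punchOut-< {suc n} {fsuc q} {fzero}  q≢a _         = refl
toℕ-punchOut-< {suc n} {fsuc q} {fsuc a} q≢a (s≤s a<q) = cong suc (toℕ-punchOut-< (q≢a ∘ cong fsuc) a<q)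

0<toℕ : {x : Fin (suc n)} → x ≢ fzero → 0 ℕ.< toℕ x
0<toℕ x≢0 = n≢0⇒n>0 (x≢0 ∘ toℕ-injective)

one : Fin (suc (suc n))
one = fsuc fzero

1<toℕ : {x : Fin (suc (suc n))} → x ≢ fzero → x ≢ one → 1 ℕ.< toℕ x
1<toℕ {x = fzero}         x≢0 _   = ⊥-elim (x≢0 refl)
1<toℕ {x = fsuc fzero}    _   x≢1 = ⊥-elim (x≢1 refl)
1<toℕ {x = fsuc (fsuc x)} _   _   = s≤s (s≤s z≤n)

IsPermutation : Vec (Fin n) n → Set
IsPermutation σ = Injective _≡_ _≡_ (lookup σ)

allVecs-suc : ∀ m n → allVecs m (suc n) ≡ cartesianProductWith _∷_ (allFin m) (allVecs m n)
allVecs-suc m n = concatMap-map (allFin m)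
  where
  concatMap-map : ∀ xs → concatMap (λ i → map (i ∷_) (allVecs m n)) xs ≡ cartesianProductWith _∷_ xs (allVecs m n)
  concatMap-map []       = refl
  concatMap-map (x ∷ xs) = cong (map (x ∷_) (allVecs m n) ++_) (concatMap-map xs)

∈-allVecs : ∀ {m} n (v : Vec (Fin m) n) → v ∈ allVecs m n
∈-allVecs zero    []      = here refl
∈-allVecs {m} (suc n) (x ∷ v) =
  subst ((x ∷ v) ∈_) (sym (allVecs-suc m n)) (∈-cartesianProductWith⁺ _∷_ (∈-allFin x) (∈-allVecs n v))

allVecs-unique : ∀ m n → Unique (allVecs m n)
allVecs-unique m zero    = [] ∷ []
allVecs-unique m (suc n) =
  subst Unique (sym (allVecs-suc m n)) (cartesianProductWith⁺ _∷_ ∷-injective (allFin⁺ m) (allVecs-unique m n))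

isPerm⇔IsPermutation : (σ : Vec (Fin n) n) → T (isPerm σ) ⇔ IsPermutation σ
isPerm⇔IsPermutation {n} σ = mk⇔ to from
  where
  distinct? : Fin n → Fin n → Bool
  distinct? p q = ⌊ p Fin.≟ q ⌋ Bool.∨ not ⌊ lookup σ p Fin.≟ lookup σ q ⌋
  row : Fin n → Bool
  row p = Data.Bool.ListAction.all (distinct? p) (allFin n)
  rowTrue : T (isPerm σ) → ∀ p → T (row p)
  rowTrue t p = All.lookup (All.all⁺ row (allFin n) t) (∈-allFin p)
  to : T (isPerm σ) → IsPermutation σ
  to t {p} {q} σp≡σq
    with Equivalence.to (T-∨ {⌊ p Fin.≟ q ⌋}) (All.lookup (All.all⁺ (distinct? p) (allFin n) (rowTrue t p)) (∈-allFin q))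
  ... | inj₁ p≡q   = toWitness p≡q
  ... | inj₂ σp≢σq = ⊥-elim (toWitnessFalse σp≢σq σp≡σq)
  from : IsPermutation σ → T (isPerm σ)
  from inj = All.all⁻ row {allFin n} (All.tabulate λ {p} _ →
    All.all⁻ (distinct? p) {allFin n} (All.tabulate λ {q} _ → Equivalence.from T-∨ (distinct p q)))
    where
    distinct : ∀ p q → T ⌊ p Fin.≟ q ⌋ ⊎ T (not ⌊ lookup σ p Fin.≟ lookup σ q ⌋)
    distinct p q with p Fin.≟ q
    ... | yes p≡q = inj₁ _
    ... | no p≢q  = inj₂ (fromWitnessFalse (p≢q ∘ inj))

∈-Sn⁻ : {σ : Vec (Fin n) n} → σ ∈ Sn n → IsPermutation σ
∈-Sn⁻ {n} {σ} σ∈ =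
  Equivalence.to (isPerm⇔IsPermutation σ)
    (Equivalence.from T-≡ (proj₂ (∈-filter⁻ (λ σ → isPerm σ Bool.≟ true) {xs = allVecs n n} σ∈)))

∈-Sn⁺ : {σ : Vec (Fin n) n} → IsPermutation σ → σ ∈ Sn n
∈-Sn⁺ {σ = σ} σ-perm =
  ∈-filter⁺ (λ σ → isPerm σ Bool.≟ true) (∈-allVecs _ σ) (Equivalence.to T-≡ (Equivalence.from (isPerm⇔IsPermutation σ) σ-perm))

Sn-unique : ∀ n → Unique (Sn n)
Sn-unique n = filter⁺ _ (allVecs-unique n n)

IsPermutation⇒surjective : ∀ {σ : Vec (Fin (suc n)) (suc n)} → IsPermutation σ → ∀ y → ∃ λ x → lookup σ x ≡ y
IsPermutation⇒surjective {n} {σ} σ-perm y with any? (λ x → lookup σ x Fin.≟ y)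
... | yes hit = hit
... | no miss = ⊥-elim (<-irrefl refl (injective⇒≤ {f = λ x → punchOut (avoids x)} (σ-perm ∘ punchOut-injective (avoids _) (avoids _))))
  where
  avoids : ∀ x → y ≢ lookup σ x
  avoids x y≡σx = miss (x , sym y≡σx)

record Match132 (σ : Vec (Fin n) n) (m : Fin n) : Set where
  constructor match
  field
    {i j}  : Fin n
    i<j    : i < j
    j<m    : j < m
    σi<σm  : lookup σ i < lookup σ m
    σm<σj  : lookup σ m < lookup σ j

match132⇔Match132 : (σ : Vec (Fin n) n) (m : Fin n) → T (match132 σ m) ⇔ Match132 σ m
match132⇔Match132 {n} σ m = mk⇔ to from
  where
  is132 : Fin n → Fin n → Bool
  is132 j i = ⌊ i Fin.<? j ⌋ ∧ ⌊ j Fin.<? m ⌋ ∧ ⌊ lookup σ i Fin.<? lookup σ m ⌋ ∧ ⌊ lookup σ m Fin.<? lookup σ j ⌋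
  some-i : Fin n → Bool
  some-i j = Data.Bool.ListAction.any (is132 j) (allFin n)
  to : T (match132 σ m) → Match132 σ m
  to t with j , tj ← satisfied (any⁻ some-i (allFin n) t)
       with i , ti ← satisfied (any⁻ (is132 j) (allFin n) tj)
       with i<j , t₁ ← Equivalence.to (T-∧ {⌊ i Fin.<? j ⌋}) ti
       with j<m , t₂ ← Equivalence.to (T-∧ {⌊ j Fin.<? m ⌋}) t₁
       with σi<σm , σm<σj ← Equivalence.to (T-∧ {⌊ lookup σ i Fin.<? lookup σ m ⌋}) t₂
    = match (toWitness i<j) (toWitness j<m) (toWitness σi<σm) (toWitness σm<σj)
  from : Match132 σ m → T (match132 σ m)
  from (match {i} {j} i<j j<m σi<σm σm<σj) =
    any⁺ some-i (lose (∈-allFin j) (any⁺ (is132 j) (lose (∈-allFin i)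
      (Equivalence.from (T-∧ {⌊ i Fin.<? j ⌋}) (fromWitness i<j ,
       Equivalence.from (T-∧ {⌊ j Fin.<? m ⌋}) (fromWitness j<m ,
       Equivalence.from (T-∧ {⌊ lookup σ i Fin.<? lookup σ m ⌋}) (fromWitness σi<σm , fromWitness σm<σj)))))))

atOne⇔ : ∀ c (σ : Vec (Fin (suc n)) (suc n)) → T (atOne (suc c) σ) ⇔ (∃ λ p → toℕ p ≡ c × lookup σ p ≡ fzero)
atOne⇔ {n} c σ = mk⇔ to from
  where
  atPosition : Fin (suc n) → Bool
  atPosition p = ((toℕ p + 1) ≡ᵇ suc c) ∧ (toℕ (lookup σ p) ≡ᵇ 0)
  to : T (atOne (suc c) σ) → ∃ λ p → toℕ p ≡ c × lookup σ p ≡ fzero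
  to t with p , tp ← satisfied (any⁻ atPosition (allFin (suc n)) t)
       with p+1≡k , σp≡0 ← Equivalence.to (T-∧ {toℕ p + 1 ≡ᵇ suc c}) tp
    = p , suc-injective (trans (+-comm 1 (toℕ p)) (≡ᵇ⇒≡ _ _ p+1≡k)) , toℕ-injective (≡ᵇ⇒≡ _ 0 σp≡0)
  from : (∃ λ p → toℕ p ≡ c × lookup σ p ≡ fzero) → T (atOne (suc c) σ)
  from (p , refl , σp≡0) =
    any⁺ atPosition (lose (∈-allFin p) (Equivalence.from T-∧ (≡⇒≡ᵇ _ _ (+-comm (toℕ p) 1) , ≡⇒≡ᵇ _ 0 (cong toℕ σp≡0))))

#P : ℕ → ℕ → ℕ → ℕ
#P m k j = count (λ σ → atOne k σ ∧ (pmp132 σ ≡ᵇ j)) (Sn m)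

X·P : ∀ m k j → X· (P m k) j ≡ + count (λ σ → atOne k σ ∧ (suc (pmp132 σ) ≡ᵇ j)) (Sn m)
X·P m k zero    = cong +_ (sym (count-none (λ σ → proj₂ ∘ Equivalence.to (T-∧ {atOne k σ})) (Sn m)))
X·P m k (suc j) = refl

atOne-out-of-range : ∀ c (σ : Vec (Fin (suc n)) (suc n)) → suc n ≤ c → ¬ T (atOne (suc c) σ)
atOne-out-of-range c σ n<c t with p , refl , _ ← Equivalence.to (atOne⇔ c σ) t = <⇒≱ (toℕ<n p) n<c

#P-out-of-range : ∀ m c j → m ≤ c → #P m (suc c) j ≡ 0
#P-out-of-range zero    c j _   = refl
#P-out-of-range (suc m) c j m<c =
  count-none (λ σ → atOne-out-of-range c σ m<c ∘ proj₁ ∘ Equivalence.to (T-∧ {atOne (suc c) σ})) (Sn (suc m))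

lookup-ext : {u v : Vec A n} → lookup u ≗ lookup v → u ≡ v
lookup-ext {u = u} {v} u≗v = trans (sym (tabulate∘lookup u)) (trans (tabulate-cong u≗v) (tabulate∘lookup v))

insert : Vec (Fin n) n → Fin (suc n) → Fin (suc n) → Vec (Fin (suc n)) (suc n)
insert τ q v = insertAt (Vec.map (punchIn v) τ) q v

lookup-insert : ∀ (τ : Vec (Fin n) n) q v → lookup (insert τ q v) q ≡ v
lookup-insert τ q v = insertAt-lookup (Vec.map (punchIn v) τ) q v

lookup-insert-punchIn : ∀ (τ : Vec (Fin n) n) q v r → lookup (insert τ q v) (punchIn q r) ≡ punchIn v (lookup τ r)
lookup-insert-punchIn τ q v r = trans (insertAt-punchIn (Vec.map (punchIn v) τ) q v r) (lookup-map r (punchIn v) τ)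

insert-isPermutation : ∀ {τ : Vec (Fin n) n} q v → IsPermutation τ → IsPermutation (insert τ q v)
insert-isPermutation {τ = τ} q v τ-perm {a} {b} with punchInView q a | punchInView q b
... | at-q      | at-q      = λ _ → refl
... | at-q      | punched s = λ v≡ → ⊥-elim (punchInᵢ≢i v (lookup τ s)
  (sym (trans (sym (lookup-insert τ q v)) (trans v≡ (lookup-insert-punchIn τ q v s)))))
... | punched r | at-q      = λ ≡v → ⊥-elim (punchInᵢ≢i v (lookup τ r)
  (trans (sym (lookup-insert-punchIn τ q v r)) (trans ≡v (lookup-insert τ q v))))
... | punched r | punched s = λ e → cong (punchIn q) (τ-perm (punchIn-injective v _ _
  (trans (sym (lookup-insert-punchIn τ q v r)) (trans e (lookup-insert-punchIn τ q v s)))))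

insert-injective : ∀ (τ τ′ : Vec (Fin n) n) q v → insert τ q v ≡ insert τ′ q v → τ ≡ τ′
insert-injective τ τ′ q v e = lookup-ext λ r → punchIn-injective v _ _
  (trans (sym (lookup-insert-punchIn τ q v r)) (trans (cong (λ σ → lookup σ (punchIn q r)) e) (lookup-insert-punchIn τ′ q v r)))

module _ (σ : Vec (Fin (suc n)) (suc n)) (σ-perm : IsPermutation σ) where

  delete : Fin (suc n) → Vec (Fin n) n
  delete q = Vec.tabulate λ r → punchOut {i = lookup σ q} {j = lookup σ (punchIn q r)} (punchInᵢ≢i q r ∘ sym ∘ σ-perm)

  lookup-delete : ∀ q r → punchIn (lookup σ q) (lookup (delete q) r) ≡ lookup σ (punchIn q r)
  lookup-delete q r = trans (cong (punchIn (lookup σ q)) (lookup∘tabulate _ r)) (punchIn-punchOut _)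

  insert-delete : ∀ q → insert (delete q) q (lookup σ q) ≡ σ
  insert-delete q = lookup-ext λ a → lookupAt (punchInView q a)
    where
    lookupAt : ∀ {a} → PunchInView q a → lookup (insert (delete q) q (lookup σ q)) a ≡ lookup σ a
    lookupAt at-q        = lookup-insert (delete q) q (lookup σ q)
    lookupAt (punched r) = trans (lookup-insert-punchIn (delete q) q (lookup σ q) r) (lookup-delete q r)

  delete-isPermutation : ∀ q → IsPermutation (delete q)
  delete-isPermutation q {r} {s} e = punchIn-injective q r s (σ-perm
    (trans (sym (lookup-delete q r)) (trans (cong (punchIn (lookup σ q)) e) (lookup-delete q s))))

module _ {τ : Vec (Fin n) n} {q v : Fin (suc n)} where

  match-insert⁺ : ∀ {r} → Match132 τ r → Match132 (insert τ q v) (punchIn q r)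
  match-insert⁺ {r} (match {i} {j} i<j j<r τi<τr τr<τj) = match
    (punchIn-mono-< q i j i<j) (punchIn-mono-< q j r j<r)
    (subst₂ _<_ (sym (lookup-insert-punchIn τ q v i)) (sym (lookup-insert-punchIn τ q v r)) (punchIn-mono-< v _ _ τi<τr))
    (subst₂ _<_ (sym (lookup-insert-punchIn τ q v r)) (sym (lookup-insert-punchIn τ q v j)) (punchIn-mono-< v _ _ τr<τj))

module _ {τ : Vec (Fin (suc n)) (suc n)} (τ-perm : IsPermutation τ)
         {r₀ : Fin (suc n)} (τr₀≡0 : lookup τ r₀ ≡ fzero)
         {q : Fin (suc (suc n))} (r₀<q : r₀ < q) where

  -- The new entry v ≤ 1 cannot be the "3" of a match; where it is the "1", the 1 of τ at r₀ < q takes its place.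
  match-insert⁻ : ∀ {v r} → toℕ v ≤ 1 → Match132 (insert τ q v) (punchIn q r) → Match132 τ r
  match-insert⁻ {v} {r} v≤1 (match {i} {j} i<j j<m σi<σm σm<σj) = pullback (punchInView q i) (punchInView q j) i<j j<m σi<σm σm<σj
    where
    σ : Vec (Fin (suc (suc n))) (suc (suc n))
    σ = insert τ q v
    σ-punchIn : ∀ s → lookup σ (punchIn q s) ≡ punchIn v (lookup τ s)
    σ-punchIn = lookup-insert-punchIn τ q v
    pullback : ∀ {i j} → PunchInView q i → PunchInView q j → i < j → j < punchIn q r →
      lookup σ i < lookup σ (punchIn q r) → lookup σ (punchIn q r) < lookup σ j → Match132 τ r
    pullback _ at-q _ _ σi<σm σm<σq
      with ≤-trans (s≤s σi<σm) (≤-trans (subst (toℕ (lookup σ (punchIn q r)) ℕ.<_) (cong toℕ (lookup-insert τ q v)) σm<σq) v≤1)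
    ... | s≤s ()
    pullback (punched i) (punched j) i<j j<m σi<σm σm<σj = match
      (punchIn-cancel-< q i j i<j) (punchIn-cancel-< q j r j<m)
      (punchIn-cancel-< v _ _ (subst₂ _<_ (σ-punchIn i) (σ-punchIn r) σi<σm))
      (punchIn-cancel-< v _ _ (subst₂ _<_ (σ-punchIn r) (σ-punchIn j) σm<σj))
    pullback at-q (punched j) q<j j<m _ σm<σj = match
      r₀<j (punchIn-cancel-< q j r j<m) (subst (_< lookup τ r) (sym τr₀≡0) (0<toℕ τr≢0))
      (punchIn-cancel-< v _ _ (subst₂ _<_ (σ-punchIn r) (σ-punchIn j) σm<σj))
      where
      r₀<j : r₀ < j
      r₀<j = punchIn-cancel-< q r₀ j (subst (ℕ._< toℕ (punchIn q j)) (sym (toℕ-punchIn-< q r₀ r₀<q)) (<-trans r₀<q q<j))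
      τr≢0 : lookup τ r ≢ fzero
      τr≢0 τr≡0 = <-irrefl (cong toℕ (τ-perm (trans τr₀≡0 (sym τr≡0)))) (<-trans r₀<j (punchIn-cancel-< q j r j<m))

  match-insert⇔ : ∀ {v} → toℕ v ≤ 1 → ∀ r → T (match132 (insert τ q v) (punchIn q r)) ⇔ T (match132 τ r)
  match-insert⇔ {v} v≤1 r = mk⇔
    (Equivalence.from (match132⇔Match132 τ r) ∘ match-insert⁻ v≤1 ∘ Equivalence.to (match132⇔Match132 (insert τ q v) (punchIn q r)))
    (Equivalence.from (match132⇔Match132 (insert τ q v) (punchIn q r)) ∘ match-insert⁺ ∘ Equivalence.to (match132⇔Match132 τ r))

  pmp-insert : ∀ {v} → toℕ v ≤ 1 → pmp132 (insert τ q v) ≡ count (match132 (insert τ q v)) [ q ] + pmp132 τ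
  pmp-insert {v} v≤1 = begin
    count isMatch (allFin (suc (suc n)))                        ≡⟨ count-↭ isMatch (allFin-punchIn-↭ q) ⟩
    count isMatch ([ q ] ++ map (punchIn q) (allFin (suc n)))   ≡⟨ count-++ isMatch [ q ] _ ⟩
    atQ + count isMatch (map (punchIn q) (allFin (suc n)))      ≡⟨ cong (_+_ atQ) (count-map isMatch (punchIn q) (allFin _)) ⟩
    atQ + count (isMatch ∘ punchIn q) (allFin (suc n))          ≡⟨ cong (_+_ atQ) (count-cong (match-insert⇔ v≤1) (allFin _)) ⟩
    atQ + pmp132 τ                                              ∎
    where
    open ≡-Reasoning
    isMatch : Fin (suc (suc n)) → Bool
    isMatch = match132 (insert τ q v)
    atQ : ℕ
    atQ = count isMatch [ q ]

  pmp-insert-zero : pmp132 (insert τ q fzero) ≡ pmp132 τ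
  pmp-insert-zero = trans (pmp-insert z≤n)
    (cong (_+ pmp132 τ) (count-[x]-reject (match132 σ₀) q (noMatch ∘ Equivalence.to (match132⇔Match132 σ₀ q))))
    where
    σ₀ : Vec (Fin (suc (suc n))) (suc (suc n))
    σ₀ = insert τ q fzero
    noMatch : ¬ Match132 σ₀ q
    noMatch (match {i} _ _ σi<σq _) with () ← subst (toℕ (lookup σ₀ i) ℕ.<_) (cong toℕ (lookup-insert τ q fzero)) σi<σq

  private
    σ₁ : Vec (Fin (suc (suc n))) (suc (suc n))
    σ₁ = insert τ q one

    σ₁-perm : IsPermutation σ₁
    σ₁-perm = insert-isPermutation q one τ-perm

    toℕ-r₀′ : toℕ (punchIn q r₀) ≡ toℕ r₀
    toℕ-r₀′ = toℕ-punchIn-< q r₀ r₀<q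

    σ₁r₀′≡0 : lookup σ₁ (punchIn q r₀) ≡ fzero
    σ₁r₀′≡0 = trans (lookup-insert-punchIn τ q one r₀) (cong (punchIn one) τr₀≡0)

  pmp-insert-one-adjacent : toℕ q ≡ suc (toℕ r₀) → pmp132 σ₁ ≡ pmp132 τ
  pmp-insert-one-adjacent q≡r₀+1 =
    trans (pmp-insert (s≤s z≤n))
      (cong (_+ pmp132 τ) (count-[x]-reject (match132 σ₁) q (noMatch ∘ Equivalence.to (match132⇔Match132 σ₁ q))))
    where
    noMatch : ¬ Match132 σ₁ q
    noMatch (match {i} {j} i<j j<q σi<σq _) = <-irrefl refl (≤-trans r₀<j (ℕ.s≤s⁻¹ (subst (toℕ j ℕ.<_) q≡r₀+1 j<q)))
      where
      i≡r₀′ : i ≡ punchIn q r₀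
      i≡r₀′ = σ₁-perm (trans (toℕ-injective (n<1⇒n≡0 σi<1)) (sym σ₁r₀′≡0))
        where
        σi<1 : toℕ (lookup σ₁ i) ℕ.< 1
        σi<1 = subst (toℕ (lookup σ₁ i) ℕ.<_) (cong toℕ (lookup-insert τ q one)) σi<σq
      r₀<j : toℕ r₀ ℕ.< toℕ j
      r₀<j = subst (ℕ._< toℕ j) (trans (cong toℕ i≡r₀′) toℕ-r₀′) i<j

  pmp-insert-one-far : suc (toℕ r₀) ℕ.< toℕ q → pmp132 σ₁ ≡ suc (pmp132 τ)
  pmp-insert-one-far r₀+1<q =
    trans (pmp-insert (s≤s z≤n))
      (cong (_+ pmp132 τ) (count-[x]-accept (match132 σ₁) q (Equivalence.from (match132⇔Match132 σ₁ q) match-at-q)))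
    where
    j : Fin (suc (suc n))
    j = fromℕ< (<-trans r₀+1<q (toℕ<n q))
    toℕ-j : toℕ j ≡ suc (toℕ r₀)
    toℕ-j = toℕ-fromℕ< (<-trans r₀+1<q (toℕ<n q))
    j<q : j < q
    j<q = subst (ℕ._< toℕ q) (sym toℕ-j) r₀+1<q
    σj≢0 : lookup σ₁ j ≢ fzero
    σj≢0 σj≡0 = 1+n≢n (trans (sym toℕ-j) (trans (cong toℕ (σ₁-perm (trans σj≡0 (sym σ₁r₀′≡0)))) toℕ-r₀′))
    σj≢1 : lookup σ₁ j ≢ one
    σj≢1 σj≡1 = <-irrefl (cong toℕ (σ₁-perm (trans σj≡1 (sym (lookup-insert τ q one))))) j<q
    match-at-q : Match132 σ₁ q
    match-at-q = match {i = punchIn q r₀} {j = j}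
      (subst₂ ℕ._<_ (sym toℕ-r₀′) (sym toℕ-j) ≤-refl) j<q
      (subst₂ _<_ (sym σ₁r₀′≡0) (sym (lookup-insert τ q one)) (s≤s z≤n))
      (subst (ℕ._< toℕ (lookup σ₁ j)) (cong toℕ (sym (lookup-insert τ q one))) (1<toℕ σj≢0 σj≢1))

+[2+c+t]-+[1+c]-1≡+t : ∀ c t → + suc (suc (c + t)) - + suc c - + 1 ≡ + t
+[2+c+t]-+[1+c]-1≡+t zero    t = refl
+[2+c+t]-+[1+c]-1≡+t (suc c) t = trans (cong (_- + 1) (drop-suc (suc (suc (c + t))) (suc c))) (+[2+c+t]-+[1+c]-1≡+t c t)
  where
  drop-suc : ∀ a b → + suc a - + suc b ≡ + a - + b
  drop-suc a b = trans (ℤ.[+m]-[+n]≡m⊖n (suc a) (suc b)) (trans (ℤ.[1+m]⊖[1+n]≡m⊖n a b) (sym (ℤ.[+m]-[+n]≡m⊖n a b)))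

-- σ ranges over S_{n+2}, its 1 sits at the 0-based position c (so k = c + 1), and j is the exponent of x.
module Decomposition (n c j : ℕ) (c<n+2 : c ℕ.< suc (suc n)) where

  c′ : Fin (suc (suc n))
  c′ = fromℕ< c<n+2

  toℕ-c′ : toℕ c′ ≡ c
  toℕ-c′ = toℕ-fromℕ< c<n+2

  Counted : Vec (Fin (suc (suc n))) (suc (suc n)) → Bool
  Counted σ = atOne (suc c) σ ∧ (pmp132 σ ≡ᵇ j)

  Admissible : ℕ → Vec (Fin (suc n)) (suc n) → Bool
  Admissible i τ with <-cmp i c
  ... | tri< _ _ _ = atOne (suc i) τ ∧ (pmp132 τ ≡ᵇ j)
  ... | tri≈ _ _ _ = false
  ... | tri> _ _ _ with i ℕ.≟ suc c
  ...   | yes _ = atOne (suc c) τ ∧ (pmp132 τ ≡ᵇ j)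
  ...   | no  _ = atOne (suc c) τ ∧ (suc (pmp132 τ) ≡ᵇ j)

  AdmissiblePair : Fin (suc (suc n)) × Vec (Fin (suc n)) (suc n) → Bool
  AdmissiblePair (p , τ) = Admissible (toℕ p) τ

  -- p is where σ gets its 2: left of c it is also where τ has its 1, so the 1 of σ is inserted at c;
  -- right of c the 2 is inserted at p.
  build : Fin (suc (suc n)) × Vec (Fin (suc n)) (suc n) → Vec (Fin (suc (suc n))) (suc (suc n))
  build (p , τ) with <-cmp (toℕ p) c
  ... | tri< _ _ _ = insert τ c′ fzero
  ... | tri≈ _ _ _ = insert τ p one
  ... | tri> _ _ _ = insert τ p one

  build-injectiveʳ : ∀ p τ τ′ → build (p , τ) ≡ build (p , τ′) → τ ≡ τ′
  build-injectiveʳ p τ τ′ with <-cmp (toℕ p) c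
  ... | tri< _ _ _ = insert-injective τ τ′ c′ fzero
  ... | tri≈ _ _ _ = insert-injective τ τ′ p one
  ... | tri> _ _ _ = insert-injective τ τ′ p one

  record Built (p : Fin (suc (suc n))) (σ : Vec (Fin (suc (suc n))) (suc (suc n))) : Set where
    field
      perm  : IsPermutation σ
      σc≡0  : lookup σ c′ ≡ fzero
      σp≡1  : lookup σ p ≡ one
      pmp≡j : pmp132 σ ≡ j

  private
    split∧ : ∀ {a} b → T (a ∧ b) → T a × T b
    split∧ {a} b = Equivalence.to (T-∧ {a} {b})

  builtBefore : ∀ p {τ} → IsPermutation τ → toℕ p ℕ.< c → ∀ {ℓ} → toℕ ℓ ≡ toℕ p → lookup τ ℓ ≡ fzero →
    pmp132 τ ≡ j → Built p (insert τ c′ fzero)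
  builtBefore p {τ} τ-perm p<c {ℓ} toℕ-ℓ τℓ≡0 pmpτ≡j = record
    { perm  = insert-isPermutation c′ fzero τ-perm
    ; σc≡0  = lookup-insert τ c′ fzero
    ; σp≡1  = subst (λ a → lookup (insert τ c′ fzero) a ≡ one) ℓ′≡p
                (trans (lookup-insert-punchIn τ c′ fzero ℓ) (cong (punchIn fzero) τℓ≡0))
    ; pmp≡j = trans (pmp-insert-zero τ-perm τℓ≡0 ℓ<c′) pmpτ≡j }
    where
    ℓ<c′ : ℓ < c′
    ℓ<c′ = subst₂ ℕ._<_ (sym toℕ-ℓ) (sym toℕ-c′) p<c
    ℓ′≡p : punchIn c′ ℓ ≡ p
    ℓ′≡p = toℕ-injective (trans (toℕ-punchIn-< c′ ℓ ℓ<c′) toℕ-ℓ)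

  builtAfter : ∀ p {τ} → IsPermutation τ → ∀ {r₀} → toℕ r₀ ≡ c → r₀ < p → lookup τ r₀ ≡ fzero →
    pmp132 (insert τ p one) ≡ j → Built p (insert τ p one)
  builtAfter p {τ} τ-perm {r₀} toℕ-r₀ r₀<p τr₀≡0 pmp≡j = record
    { perm  = insert-isPermutation p one τ-perm
    ; σc≡0  = subst (λ a → lookup (insert τ p one) a ≡ fzero) r₀′≡c′
                (trans (lookup-insert-punchIn τ p one r₀) (cong (punchIn one) τr₀≡0))
    ; σp≡1  = lookup-insert τ p one
    ; pmp≡j = pmp≡j }
    where
    r₀′≡c′ : punchIn p r₀ ≡ c′
    r₀′≡c′ = toℕ-injective (trans (toℕ-punchIn-< p r₀ r₀<p) (trans toℕ-r₀ (sym toℕ-c′)))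

  built : ∀ p τ → IsPermutation τ → T (Admissible (toℕ p) τ) → Built p (build (p , τ))
  built p τ τ-perm adm with <-cmp (toℕ p) c
  ... | tri< p<c _ _
        with isOne , pmp ← split∧ (pmp132 τ ≡ᵇ j) adm
        with ℓ , toℕ-ℓ , τℓ≡0 ← Equivalence.to (atOne⇔ (toℕ p) τ) isOne
        = builtBefore p τ-perm p<c toℕ-ℓ τℓ≡0 (≡ᵇ⇒≡ _ _ pmp)
  ... | tri> _ _ c<p with toℕ p ℕ.≟ suc c
  ...   | yes p≡c+1
          with isOne , pmp ← split∧ (pmp132 τ ≡ᵇ j) adm
          with r₀ , refl , τr₀≡0 ← Equivalence.to (atOne⇔ c τ) isOne
          = builtAfter p τ-perm refl c<p τr₀≡0 (trans (pmp-insert-one-adjacent τ-perm τr₀≡0 c<p p≡c+1) (≡ᵇ⇒≡ _ _ pmp))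
  ...   | no p≢c+1
          with isOne , pmp ← split∧ (suc (pmp132 τ) ≡ᵇ j) adm
          with r₀ , refl , τr₀≡0 ← Equivalence.to (atOne⇔ c τ) isOne
          = builtAfter p τ-perm refl c<p τr₀≡0
              (trans (pmp-insert-one-far τ-perm τr₀≡0 c<p (≤∧≢⇒< c<p (p≢c+1 ∘ sym))) (≡ᵇ⇒≡ _ _ pmp))

  module Preimage (σ : Vec (Fin (suc (suc n))) (suc (suc n))) (σ-perm : IsPermutation σ) (σc′≡0 : lookup σ c′ ≡ fzero)
                  (pmpσ≡j : pmp132 σ ≡ j) (p₁ : Fin (suc (suc n))) (σp₁≡1 : lookup σ p₁ ≡ one) where

    p₁≢c′ : p₁ ≢ c′
    p₁≢c′ p₁≡c′ with () ← trans (sym σp₁≡1) (trans (cong (lookup σ) p₁≡c′) σc′≡0)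

    deleted-zero : ∀ q r → lookup σ (punchIn q r) ≡ punchIn (lookup σ q) fzero → lookup (delete σ σ-perm q) r ≡ fzero
    deleted-zero q r σr′≡ = punchIn-injective (lookup σ q) _ _ (trans (lookup-delete σ σ-perm q r) σr′≡)

    module Before (p₁<c : toℕ p₁ ℕ.< c) where
      τ : Vec (Fin (suc n)) (suc n)
      τ = delete σ σ-perm c′
      p₁<c′ : p₁ < c′
      p₁<c′ = subst (toℕ p₁ ℕ.<_) (sym toℕ-c′) p₁<c
      ℓ : Fin (suc n)
      ℓ = punchOut (p₁≢c′ ∘ sym)
      toℕ-ℓ : toℕ ℓ ≡ toℕ p₁
      toℕ-ℓ = toℕ-punchOut-< (p₁≢c′ ∘ sym) p₁<c′
      ℓ<c′ : ℓ < c′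
      ℓ<c′ = subst (ℕ._< toℕ c′) (sym toℕ-ℓ) p₁<c′
      τℓ≡0 : lookup τ ℓ ≡ fzero
      τℓ≡0 = deleted-zero c′ ℓ
        (trans (cong (lookup σ) (punchIn-punchOut _)) (trans σp₁≡1 (cong (λ v → punchIn v fzero) (sym σc′≡0))))
      σ≡ : insert τ c′ fzero ≡ σ
      σ≡ = trans (cong (insert τ c′) (sym σc′≡0)) (insert-delete σ σ-perm c′)
      pmpτ≡j : pmp132 τ ≡ j
      pmpτ≡j = trans (sym (pmp-insert-zero (delete-isPermutation σ σ-perm c′) τℓ≡0 ℓ<c′)) (trans (cong pmp132 σ≡) pmpσ≡j)

      preimage : ∃ λ τ → IsPermutation τ × T (atOne (suc (toℕ p₁)) τ ∧ (pmp132 τ ≡ᵇ j)) × insert τ c′ fzero ≡ σ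
      preimage = τ , delete-isPermutation σ σ-perm c′ ,
        Equivalence.from (T-∧ {atOne (suc (toℕ p₁)) τ}) (Equivalence.from (atOne⇔ (toℕ p₁) τ) (ℓ , toℕ-ℓ , τℓ≡0) , ≡⇒≡ᵇ _ _ pmpτ≡j) ,
        σ≡

    module After (c<p₁ : c ℕ.< toℕ p₁) where
      τ : Vec (Fin (suc n)) (suc n)
      τ = delete σ σ-perm p₁
      c′<p₁ : c′ < p₁
      c′<p₁ = subst (ℕ._< toℕ p₁) (sym toℕ-c′) c<p₁
      r₀ : Fin (suc n)
      r₀ = punchOut p₁≢c′
      toℕ-r₀ : toℕ r₀ ≡ c
      toℕ-r₀ = trans (toℕ-punchOut-< p₁≢c′ c′<p₁) toℕ-c′
      r₀<p₁ : r₀ < p₁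
      r₀<p₁ = subst (ℕ._< toℕ p₁) (sym toℕ-r₀) c<p₁
      τr₀≡0 : lookup τ r₀ ≡ fzero
      τr₀≡0 = deleted-zero p₁ r₀
        (trans (cong (lookup σ) (punchIn-punchOut _)) (trans σc′≡0 (cong (λ v → punchIn v fzero) (sym σp₁≡1))))
      σ≡ : insert τ p₁ one ≡ σ
      σ≡ = trans (cong (insert τ p₁) (sym σp₁≡1)) (insert-delete σ σ-perm p₁)
      τ-perm : IsPermutation τ
      τ-perm = delete-isPermutation σ σ-perm p₁
      zero-at-c : T (atOne (suc c) τ)
      zero-at-c = Equivalence.from (atOne⇔ c τ) (r₀ , toℕ-r₀ , τr₀≡0)
      preimage-adjacent : toℕ p₁ ≡ suc c →
        ∃ λ τ → IsPermutation τ × T (atOne (suc c) τ ∧ (pmp132 τ ≡ᵇ j)) × insert τ p₁ one ≡ σ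
      preimage-adjacent p₁≡c+1 = τ , τ-perm , Equivalence.from (T-∧ {atOne (suc c) τ}) (zero-at-c , ≡⇒≡ᵇ _ _
        (trans (sym (pmp-insert-one-adjacent τ-perm τr₀≡0 r₀<p₁ (trans p₁≡c+1 (cong suc (sym toℕ-r₀)))))
               (trans (cong pmp132 σ≡) pmpσ≡j))) , σ≡

      preimage-far : toℕ p₁ ≢ suc c →
        ∃ λ τ → IsPermutation τ × T (atOne (suc c) τ ∧ (suc (pmp132 τ) ≡ᵇ j)) × insert τ p₁ one ≡ σ
      preimage-far p₁≢c+1 = τ , τ-perm , Equivalence.from (T-∧ {atOne (suc c) τ}) (zero-at-c , ≡⇒≡ᵇ _ _
        (trans (sym (pmp-insert-one-far τ-perm τr₀≡0 r₀<p₁ r₀+1<p₁)) (trans (cong pmp132 σ≡) pmpσ≡j))) , σ≡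
        where
        r₀+1<p₁ : suc (toℕ r₀) ℕ.< toℕ p₁
        r₀+1<p₁ = subst (ℕ._< toℕ p₁) (cong suc (sym toℕ-r₀)) (≤∧≢⇒< c<p₁ (p₁≢c+1 ∘ sym))

  preimage : ∀ σ → IsPermutation σ → lookup σ c′ ≡ fzero → pmp132 σ ≡ j → ∀ p₁ → lookup σ p₁ ≡ one →
    ∃ λ τ → IsPermutation τ × T (Admissible (toℕ p₁) τ) × build (p₁ , τ) ≡ σ
  preimage σ σ-perm σc′≡0 pmpσ≡j p₁ σp₁≡1 with <-cmp (toℕ p₁) c
  ... | tri< p₁<c _ _ = Preimage.Before.preimage σ σ-perm σc′≡0 pmpσ≡j p₁ σp₁≡1 p₁<c
  ... | tri≈ _ p₁≡c _ = ⊥-elim (Preimage.p₁≢c′ σ σ-perm σc′≡0 pmpσ≡j p₁ σp₁≡1 (toℕ-injective (trans p₁≡c (sym toℕ-c′))))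
  ... | tri> _ _ c<p₁ with toℕ p₁ ℕ.≟ suc c
  ...   | yes p₁≡c+1 = Preimage.After.preimage-adjacent σ σ-perm σc′≡0 pmpσ≡j p₁ σp₁≡1 c<p₁ p₁≡c+1
  ...   | no p₁≢c+1  = Preimage.After.preimage-far σ σ-perm σc′≡0 pmpσ≡j p₁ σp₁≡1 c<p₁ p₁≢c+1

  counted : List (Vec (Fin (suc (suc n))) (suc (suc n)))
  counted = filter (λ σ → Counted σ Bool.≟ true) (Sn (suc (suc n)))

  admissible : List (Fin (suc (suc n)) × Vec (Fin (suc n)) (suc n))
  admissible = filter (λ y → AdmissiblePair y Bool.≟ true) (cartesianProduct (allFin (suc (suc n))) (Sn (suc n)))

  ∈-admissible⁻ : ∀ {p τ} → (p , τ) ∈ admissible → IsPermutation τ × T (Admissible (toℕ p) τ)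
  ∈-admissible⁻ y∈
    with y∈× , adm ← ∈-filter⁻ (λ y → AdmissiblePair y Bool.≟ true) {xs = cartesianProduct (allFin (suc (suc n))) (Sn (suc n))} y∈
    = ∈-Sn⁻ (proj₂ (∈-cartesianProduct⁻ (allFin (suc (suc n))) (Sn (suc n)) y∈×)) , Equivalence.from T-≡ adm

  ∈-admissible⁺ : ∀ {p τ} → IsPermutation τ → T (Admissible (toℕ p) τ) → (p , τ) ∈ admissible
  ∈-admissible⁺ {p} τ-perm adm =
    ∈-filter⁺ (λ y → AdmissiblePair y Bool.≟ true) (∈-cartesianProduct⁺ (∈-allFin p) (∈-Sn⁺ τ-perm)) (Equivalence.to T-≡ adm)

  build-into : ∀ {y} → y ∈ admissible → build y ∈ counted
  build-into {p , τ} y∈ with τ-perm , adm ← ∈-admissible⁻ y∈ =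
    ∈-filter⁺ (λ σ → Counted σ Bool.≟ true) (∈-Sn⁺ perm) (Equivalence.to T-≡ (Equivalence.from (T-∧ {atOne (suc c) (build (p , τ))})
      (Equivalence.from (atOne⇔ c (build (p , τ))) (c′ , toℕ-c′ , σc≡0) , ≡⇒≡ᵇ _ _ pmp≡j)))
    where
    open Built (built p τ τ-perm adm)

  build-injectiveOn : InjectiveOn build admissible
  build-injectiveOn {p , τ} {p′ , τ′} y∈ y′∈ e
    with τ-perm , adm ← ∈-admissible⁻ y∈
    with τ′-perm , adm′ ← ∈-admissible⁻ y′∈
    with refl ← Built.perm (built p τ τ-perm adm)
                  (trans (Built.σp≡1 (built p τ τ-perm adm))
                         (sym (trans (cong (λ σ → lookup σ p′) e) (Built.σp≡1 (built p′ τ′ τ′-perm adm′)))))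
    = cong (p ,_) (build-injectiveʳ p τ τ′ e)

  build-onto : ∀ {σ} → σ ∈ counted → ∃ λ y → y ∈ admissible × build y ≡ σ
  build-onto {σ} σ∈
    with σ∈Sn , counts ← ∈-filter⁻ (λ σ → Counted σ Bool.≟ true) {xs = Sn (suc (suc n))} σ∈
    with isZero , pmp ← Equivalence.to (T-∧ {atOne (suc c) σ}) (Equivalence.from T-≡ counts)
    with p₀ , toℕ-p₀ , σp₀≡0 ← Equivalence.to (atOne⇔ c σ) isZero
    with p₁ , σp₁≡1 ← IsPermutation⇒surjective {σ = σ} (∈-Sn⁻ σ∈Sn) one
    with τ , τ-perm , adm , built≡σ ← preimage σ (∈-Sn⁻ σ∈Sn)
           (subst (λ a → lookup σ a ≡ fzero) (toℕ-injective (trans toℕ-p₀ (sym toℕ-c′))) σp₀≡0) (≡ᵇ⇒≡ _ _ pmp) p₁ σp₁≡1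
    = (p₁ , τ) , ∈-admissible⁺ {p₁} τ-perm adm , built≡σ

  count-counted : count Counted (Sn (suc (suc n))) ≡ sumBelow (suc (suc n)) (λ i → count (Admissible i) (Sn (suc n)))
  count-counted = begin
    length counted   ≡⟨ length-≡-bijectiveOn build (filter⁺ _ (Sn-unique _)) (filter⁺ _ (cartesianProduct⁺ (allFin⁺ _) (Sn-unique _)))
                          build-injectiveOn build-into build-onto ⟩
    length admissible ≡⟨ count-cartesianProduct AdmissiblePair (allFin (suc (suc n))) (Sn (suc n)) ⟩
    sum (map (λ p → count (Admissible (toℕ p)) (Sn (suc n))) (allFin (suc (suc n))))
                      ≡⟨ sum-allFin (suc (suc n)) (λ i → count (Admissible i) (Sn (suc n))) ⟩
    sumBelow (suc (suc n)) (λ i → count (Admissible i) (Sn (suc n))) ∎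
    where
    open ≡-Reasoning

  admissible-before : ∀ i → i ℕ.< c → ∀ τ → T (Admissible i τ) ⇔ T (atOne (suc i) τ ∧ (pmp132 τ ≡ᵇ j))
  admissible-before i i<c τ with <-cmp i c
  ... | tri< _ _ _   = mk⇔ id id
  ... | tri≈ i≮c _ _ = ⊥-elim (i≮c i<c)
  ... | tri> i≮c _ _ = ⊥-elim (i≮c i<c)

  admissible-at : ∀ i → i ≡ c → ∀ τ → ¬ T (Admissible i τ)
  admissible-at i i≡c τ with <-cmp i c
  ... | tri< _ i≢c _ = ⊥-elim (i≢c i≡c)
  ... | tri≈ _ _ _   = id
  ... | tri> _ i≢c _ = ⊥-elim (i≢c i≡c)

  admissible-next : ∀ i → i ≡ suc c → ∀ τ → T (Admissible i τ) ⇔ T (atOne (suc c) τ ∧ (pmp132 τ ≡ᵇ j))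
  admissible-next i refl τ with <-cmp (suc c) c
  ... | tri< c+1<c _ _ = ⊥-elim (n≮n c (<-trans (n<1+n c) c+1<c))
  ... | tri≈ _ c+1≡c _ = ⊥-elim (1+n≢n c+1≡c)
  ... | tri> _ _ _ with suc c ℕ.≟ suc c
  ...   | yes _ = mk⇔ id id
  ...   | no c+1≢c+1 = ⊥-elim (c+1≢c+1 refl)

  admissible-after : ∀ i → suc c ℕ.< i → ∀ τ → T (Admissible i τ) ⇔ T (atOne (suc c) τ ∧ (suc (pmp132 τ) ≡ᵇ j))
  admissible-after i c+1<i τ with <-cmp i c
  ... | tri< i<c _ _ = ⊥-elim (n≮n c (<-trans (<-trans (n<1+n c) c+1<i) i<c))
  ... | tri≈ _ refl _ = ⊥-elim (n≮n c (<-trans (n<1+n c) c+1<i))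
  ... | tri> _ _ _ with i ℕ.≟ suc c
  ...   | yes refl = ⊥-elim (n≮n (suc c) c+1<i)
  ...   | no _ = mk⇔ id id

  private
    F : ℕ → ℕ
    F i = count (Admissible i) (Sn (suc n))

    shifted : ℕ
    shifted = count (λ τ → atOne (suc c) τ ∧ (suc (pmp132 τ) ≡ᵇ j)) (Sn (suc n))

    below : ℕ
    below = sumBelow c (λ i → #P (suc n) (suc i) j)

    next : ℕ
    next = #P (suc n) (suc c) j

    sum-before : sumBelow c F ≡ below
    sum-before = sumBelow-cong c (λ i i<c → count-cong (admissible-before i i<c) (Sn (suc n)))

    F-at : ∀ i → i ≡ c → F i ≡ 0
    F-at i i≡c = count-none (admissible-at i i≡c) (Sn (suc n))

  count-counted-inner : ∀ t → n ≡ c + t → count Counted (Sn (suc (suc n))) ≡ below + (next + t * shifted)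
  count-counted-inner t n≡c+t = begin
    count Counted (Sn (suc (suc n)))                        ≡⟨ count-counted ⟩
    sumBelow (suc (suc n)) F                                ≡⟨ cong (λ N → sumBelow N F) N≡ ⟩
    sumBelow (c + suc (suc t)) F                            ≡⟨ sumBelow-+ c (suc (suc t)) F ⟩
    sumBelow c F + (F (c + 0) + (F (c + 1) + sumBelow t (λ i → F (c + suc (suc i)))))
      ≡⟨ cong₂ _+_ sum-before (cong₂ _+_ (F-at (c + 0) (+-identityʳ c)) (cong₂ _+_ F-next sum-after)) ⟩
    below + (next + t * shifted)                            ∎
    where
    open ≡-Reasoning
    N≡ : suc (suc n) ≡ c + suc (suc t)
    N≡ = trans (cong (suc ∘ suc) n≡c+t) (sym (trans (+-suc c (suc t)) (cong suc (+-suc c t))))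
    F-next : F (c + 1) ≡ next
    F-next = count-cong (admissible-next (c + 1) (trans (+-suc c 0) (cong suc (+-identityʳ c)))) (Sn (suc n))
    sum-after : sumBelow t (λ i → F (c + suc (suc i))) ≡ t * shifted
    sum-after = trans (sumBelow-cong t (λ i _ → count-cong (admissible-after (c + suc (suc i)) (c+1<c+2+i i)) (Sn (suc n))))
                      (sumBelow-const t shifted)
      where
      c+1<c+2+i : ∀ i → suc c ℕ.< c + suc (suc i)
      c+1<c+2+i i = subst (suc c ℕ.<_) (sym (trans (+-suc c (suc i)) (cong suc (+-suc c i)))) (s≤s (s≤s (m≤m+n c i)))

  count-counted-last : c ≡ suc n → count Counted (Sn (suc (suc n))) ≡ below
  count-counted-last refl = begin
    count Counted (Sn (suc (suc n)))  ≡⟨ count-counted ⟩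
    sumBelow (suc c) F                ≡⟨ sumBelow-suc c F ⟩
    sumBelow c F + F c                ≡⟨ cong₂ _+_ sum-before (F-at c refl) ⟩
    below + 0                         ≡⟨ +-identityʳ below ⟩
    below                             ∎
    where
    open ≡-Reasoning

  RHS : ℤ
  RHS = (ΣP c (λ ℓ → P (suc n) ℓ) ⊕ (((+ suc (suc n) - + suc c - + 1) ⊙ X· (P (suc n) (suc c))) ⊕ P (suc n) (suc c))) j

  private
    ΣP≡below : ΣP c (λ ℓ → P (suc n) ℓ) j ≡ + below
    ΣP≡below = ΣP-sumBelow c (λ ℓ → P (suc n) ℓ) (λ ℓ → #P (suc n) ℓ j) j (λ _ → refl)

  recurrence-inner : ∀ t → n ≡ c + t → P (suc (suc n)) (suc c) j ≡ RHS
  recurrence-inner t refl = begin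
    + count Counted (Sn (suc (suc n)))          ≡⟨ cong +_ (count-counted-inner t refl) ⟩
    + (below + (next + t * shifted))            ≡⟨ cong (λ x → + (below + x)) (+-comm next (t * shifted)) ⟩
    + (below + (t * shifted + next))            ≡⟨ ℤ.pos-+ below _ ⟩
    + below +ℤ + (t * shifted + next)           ≡⟨ cong (+ below +ℤ_) (ℤ.pos-+ (t * shifted) next) ⟩
    + below +ℤ (+ (t * shifted) +ℤ + next)      ≡⟨ cong (λ x → + below +ℤ (x +ℤ + next)) (ℤ.pos-* t shifted) ⟩
    + below +ℤ (+ t *ℤ + shifted +ℤ + next)
      ≡⟨ cong₂ _+ℤ_ (sym ΣP≡below)
                    (cong₂ (λ a x → a *ℤ x +ℤ + next) (sym (+[2+c+t]-+[1+c]-1≡+t c t)) (sym (X·P (suc n) (suc c) j))) ⟩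
    RHS                                         ∎
    where
    open ≡-Reasoning

  -- For k = n the coefficient n - k - 1 is -1, but it multiplies P_{n-1,n} = 0.
  recurrence-last : c ≡ suc n → P (suc (suc n)) (suc c) j ≡ RHS
  recurrence-last refl = begin
    + count Counted (Sn (suc (suc n)))    ≡⟨ cong +_ (count-counted-last refl) ⟩
    + below                               ≡⟨ ℤ.+-identityʳ (+ below) ⟨
    + below +ℤ + 0                       ≡⟨ cong₂ _+ℤ_ (sym ΣP≡below) (sym no-new-terms) ⟩
    RHS                                   ∎
    where
    open ≡-Reasoning
    coef : ℤ
    coef = + suc (suc n) - + suc c - + 1
    n+1≤c : suc n ≤ c
    n+1≤c = ≤-refl
    no-new-terms : coef *ℤ X· (P (suc n) (suc c)) j +ℤ P (suc n) (suc c) j ≡ + 0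
    no-new-terms = begin
      coef *ℤ X· (P (suc n) (suc c)) j +ℤ P (suc n) (suc c) j
        ≡⟨ cong₂ (λ x y → coef *ℤ x +ℤ + y) (trans (X·P (suc n) (suc c) j) (cong +_ no-shifted)) (#P-out-of-range (suc n) c j n+1≤c) ⟩
      coef *ℤ + 0 +ℤ + 0
        ≡⟨ cong (_+ℤ + 0) (ℤ.*-zeroʳ coef) ⟩
      + 0 ∎
      where
      no-shifted : shifted ≡ 0
      no-shifted = count-none (λ σ → atOne-out-of-range c σ n+1≤c ∘ proj₁ ∘ Equivalence.to (T-∧ {atOne (suc c) σ})) (Sn (suc n))

lemma8 : (n k : ℕ) → 2 ≤ n → 1 ≤ k → k ≤ n → (j : ℕ) →
    P n k j ≡ (ΣP (k ∸ 1) (λ ℓ → P (n ∸ 1) ℓ)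
               ⊕ (((+ n - + k - + 1) ⊙ X· (P (n ∸ 1) k)) ⊕ P (n ∸ 1) k)) j
lemma8 (suc zero) _ (s≤s ()) _ _ _
lemma8 (suc (suc n)) (suc c) _ _ c<n+2@(s≤s c≤n+1) j with m≤n⇒m<n∨m≡n c≤n+1
... | inj₁ (s≤s c≤n) with t , c+t≡n ← m≤n⇒∃[o]m+o≡n c≤n = Decomposition.recurrence-inner n c j c<n+2 t (sym c+t≡n)
... | inj₂ c≡n+1     = Decomposition.recurrence-last n c j c<n+2 c≡n+1
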